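{- Let $G$ be a graph and let $Y$ be a minimal blocking set of $G$. Then: (i) $Y$ contains no vertex that is contained in every minimum vertex cover of $G$; (ii) if $Y$ contains a vertex that is not contained in any minimum vertex cover of $G$, then $|Y|=1$; (iii) $Y$ is contained in a single connected component of $G$; (iv) $\mathrm{OPT}(G-Y)+|Y|=\mathrm{OPT}(G)+1$.
   Context: All graphs are finite, simple and undirected. $\mathrm{OPT}(G)$ is the minimum vertex cover size; a minimum vertex cover is a vertex cover of size $\mathrm{OPT}(G)$. A set $Y\subseteq V(G)$ is a blocking set of $G$ if no minimum vertex cover of $G$ contains $Y$; it is a minimal blocking set if no proper subset of $Y$ is a blocking set. -}

module Defs where

open import Data.Nat using (ℕ; zero; suc; _⊓_)
open import Data.Bool using (Bool; true; false)
open import Data.Fin using (Fin)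
open import Data.Fin.Properties using (all?)
open import Data.Fin.Subset using (Subset; _∈_; _∉_; _⊆_; _⊂_; ∣_∣; ⊤; ∁; inside; outside)
open import Data.Fin.Subset.Properties using (_∈?_; _⊆?_)
open import Data.Vec using ([]; _∷_)
open import Data.List using (List; []; _∷_; map; filter; foldr; _++_)
open import Data.Product using (Σ; ∃; _×_; _,_)
open import Data.Sum using (_⊎_)
open import Relation.Nullary using (¬_; Dec)
open import Relation.Nullary.Decidable using (_×-dec_; _⊎-dec_; _→-dec_)
open import Relation.Binary.PropositionalEquality using (_≡_)
open import Data.Bool.Properties using () renaming (_≟_ to _≟ᵇ_)
open import Relation.Binary.Construct.Closure.ReflexiveTransitive using (Star)

record Graph (n : ℕ) : Set where
  field
    E      : Fin n → Fin n → Bool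
    sym    : ∀ u v → E u v ≡ E v u
    irrefl : ∀ v → E v v ≡ false
open Graph public

Adj : ∀ {n} → Graph n → Fin n → Fin n → Set
Adj G u v = E G u v ≡ true

-- Induced subgraphs G[S] are represented by their vertex set S ⊆ V(G).
-- C is a vertex cover of G[S]: C ⊆ S and every edge of G[S] has an endpoint in C.
IsVC : ∀ {n} → Graph n → Subset n → Subset n → Set
IsVC G S C = C ⊆ S × (∀ u v → u ∈ S → v ∈ S → Adj G u v → u ∈ C ⊎ v ∈ C)

IsVC? : ∀ {n} (G : Graph n) (S C : Subset n) → Dec (IsVC G S C)
IsVC? G S C = (C ⊆? S) ×-dec
  all? (λ u → all? (λ v → (u ∈? S) →-dec ((v ∈? S) →-dec
    ((E G u v ≟ᵇ true) →-dec ((u ∈? C) ⊎-dec (v ∈? C))))))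

allSubsets : ∀ n → List (Subset n)
allSubsets zero    = [] ∷ []
allSubsets (suc n) = map (outside ∷_) (allSubsets n) ++ map (inside ∷_) (allSubsets n)

-- OPT(G[S]): the minimum size of a vertex cover of G[S]
-- (S itself is always a vertex cover, so ∣ S ∣ is a valid initial bound).
OPTon : ∀ {n} → Graph n → Subset n → ℕ
OPTon G S = foldr _⊓_ ∣ S ∣ (map ∣_∣ (filter (IsVC? G S) (allSubsets _)))

OPT : ∀ {n} → Graph n → ℕ
OPT G = OPTon G ⊤

OPT-del : ∀ {n} → Graph n → Subset n → ℕ
OPT-del G Y = OPTon G (∁ Y)

IsMinVC : ∀ {n} → Graph n → Subset n → Set
IsMinVC G C = IsVC G ⊤ C × ∣ C ∣ ≡ OPT G

IsBlocking : ∀ {n} → Graph n → Subset n → Set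
IsBlocking G Y = ¬ (Σ (Subset _) λ C → IsMinVC G C × Y ⊆ C)

IsMinimalBlocking : ∀ {n} → Graph n → Subset n → Set
IsMinimalBlocking G Y = IsBlocking G Y × (∀ Z → Z ⊂ Y → ¬ IsBlocking G Z)

Connected : ∀ {n} → Graph n → Fin n → Fin n → Set
Connected G = Star (Adj G)

module Submission where

-- The argument only needs three facts about vertex covers:
--   * OPT(G[S]) is the least size of a cover of G[S], and is attained;
--   * covers of G and of G − Y translate into each other: D ↦ D ∪ Y and
--     C ↦ C ∖ Y, which yields OPT(G) < OPT(G − Y) + |Y| for every blocking
--     set, and OPT(G − Y) + |Y| ≤ |C| + 1 whenever the cover C contains all
--     of Y except possibly one vertex;
--   * two minimum covers can be spliced along a set A closed under adjacency
--     (take the first on A, the second off A) into a minimum cover.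
-- Minimality of Y says every proper subset Y ∩ A ⊂ Y lies in a minimum cover.
-- Parts (i) and (ii) split Y along a singleton {v}; part (iii) splits Y along
-- the connected component of one of its vertices (built by a closure
-- computation) and splices the two resulting covers; part (iv) combines the
-- two inequalities above, using a cover containing Y ∖ {y}.

open import Defs
open import Data.Nat using (ℕ; _+_)
open import Data.Fin using (Fin)
open import Data.Fin.Subset using (Subset; _∈_; _∉_; ∣_∣)
open import Data.Product using (Σ; _×_)
open import Relation.Nullary using (¬_)
open import Relation.Binary.PropositionalEquality using (_≡_)

open import Data.Nat using (suc; zero; _≤_; _<_; _⊓_; _≤?_)
open import Data.Nat.Properties
  using (+-suc; +-comm; ≤-reflexive; ≤-trans; ≤-antisym; ≤-pred; ≤∧≢⇒<; n≮0;
         +-monoˡ-≤; +-monoʳ-≤; +-mono-≤; +-cancelʳ-≤; ⊓-sel; m≤n⇒m⊓o≤n; m≤n⇒o⊓m≤n; module ≤-Reasoning)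
open import Data.Nat.Solver using (module +-*-Solver)
open import Data.Fin using () renaming (_≟_ to _≟ᶠ_)
open import Data.Fin.Properties using (any?)
open import Data.Fin.Subset using (_⊆_; _⊂_; ⊤; ∁; ⁅_⁆; _∪_; _∩_; inside; outside; Nonempty)
open import Data.Fin.Subset.Properties
  using (_∈?_; ∈⊤; ⊆⊤; ⊆-antisym; x∈⁅x⁆; x∈⁅y⁆⇒x≡y; ∣⁅x⁆∣≡1; x≢y⇒x∉⁅y⁆; x∈p∩q⁺; x∈p∩q⁻;
         x∈p∪q⁺; x∈p∪q⁻; p⊆p∪q; x∉p⇒x∈∁p; x∈∁p⇒x∉p; x∈p⇒x∉∁p; p⊆q⇒∣p∣≤∣q∣; p∩q⊆q;
         p⊂q⇒∣p∣<∣q∣; p⊂q⇒∁p⊃∁q; ∣p∣≤n; nonempty?)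
open import Data.Vec.Base using ([]; _∷_; here; there)
open import Data.Bool using (true)
open import Data.Bool.Properties using () renaming (_≟_ to _≟ᵇ_)
open import Data.List using (map)
open import Data.List.Properties using (foldr-preservesᵇ; foldr-preservesᵒ)
open import Data.List.Membership.Propositional using () renaming (_∈_ to _∈ˡ_)
open import Data.List.Membership.Propositional.Properties using (∈-map⁺; ∈-filter⁺; ∈-++⁺ˡ; ∈-++⁺ʳ)
import Data.List.Relation.Unary.Any as Any
import Data.List.Relation.Unary.All as All
open import Data.List.Relation.Unary.All.Properties using (all-filter) renaming (map⁺ to All-map⁺)
open import Data.Product using (_,_; proj₁; proj₂; ∃₂)
open import Data.Sum using (_⊎_; inj₁; inj₂; [_,_])
open import Data.Empty using (⊥; ⊥-elim)
open import Relation.Nullary using (Dec; yes; no)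
open import Relation.Nullary.Decidable using (decidable-stable; _×-dec_; ¬?)
open import Relation.Binary.PropositionalEquality using (refl; trans; cong; cong₂; subst; module ≡-Reasoning) renaming (sym to ≡-sym)
open import Relation.Binary.Construct.Closure.ReflexiveTransitive using (ε; _◅_; _◅◅_)

∣p∩q∣+∣p∩∁q∣≡∣p∣ : ∀ {n} (p q : Subset n) → ∣ p ∩ q ∣ + ∣ p ∩ ∁ q ∣ ≡ ∣ p ∣
∣p∩q∣+∣p∩∁q∣≡∣p∣ []            []            = refl
∣p∩q∣+∣p∩∁q∣≡∣p∣ (inside  ∷ p) (inside  ∷ q) = cong suc (∣p∩q∣+∣p∩∁q∣≡∣p∣ p q)
∣p∩q∣+∣p∩∁q∣≡∣p∣ (inside  ∷ p) (outside ∷ q) =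
  trans (+-suc ∣ p ∩ q ∣ ∣ p ∩ ∁ q ∣) (cong suc (∣p∩q∣+∣p∩∁q∣≡∣p∣ p q))
∣p∩q∣+∣p∩∁q∣≡∣p∣ (outside ∷ p) (_       ∷ q) = ∣p∩q∣+∣p∩∁q∣≡∣p∣ p q

∣p∪q∣≡∣p∣+∣q∣ : ∀ {n} (p q : Subset n) → (∀ {x} → x ∈ p → x ∉ q) → ∣ p ∪ q ∣ ≡ ∣ p ∣ + ∣ q ∣
∣p∪q∣≡∣p∣+∣q∣ []            []            disjoint = refl
∣p∪q∣≡∣p∣+∣q∣ (inside  ∷ p) (inside  ∷ q) disjoint = ⊥-elim (disjoint here here)
∣p∪q∣≡∣p∣+∣q∣ (inside  ∷ p) (outside ∷ q) disjoint =
  cong suc (∣p∪q∣≡∣p∣+∣q∣ p q (λ x∈p x∈q → disjoint (there x∈p) (there x∈q)))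
∣p∪q∣≡∣p∣+∣q∣ (outside ∷ p) (inside  ∷ q) disjoint =
  trans (cong suc (∣p∪q∣≡∣p∣+∣q∣ p q (λ x∈p x∈q → disjoint (there x∈p) (there x∈q))))
        (≡-sym (+-suc ∣ p ∣ ∣ q ∣))
∣p∪q∣≡∣p∣+∣q∣ (outside ∷ p) (outside ∷ q) disjoint =
  ∣p∪q∣≡∣p∣+∣q∣ p q (λ x∈p x∈q → disjoint (there x∈p) (there x∈q))

∩-⊂ : ∀ {n} {Y A : Subset n} {y : Fin n} → y ∈ Y → y ∉ A → Y ∩ A ⊂ Y
∩-⊂ {Y = Y} {A} y∈Y y∉A =
  (λ x∈Y∩A → proj₁ (x∈p∩q⁻ Y A x∈Y∩A)) , _ , y∈Y , (λ y∈Y∩A → y∉A (proj₂ (x∈p∩q⁻ Y A y∈Y∩A)))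

⊆-by-pieces : ∀ {n} (A : Subset n) {Y C : Subset n} → Y ∩ A ⊆ C → Y ∩ ∁ A ⊆ C → Y ⊆ C
⊆-by-pieces A inside-A outside-A {x} x∈Y with x ∈? A
... | yes x∈A = inside-A (x∈p∩q⁺ (x∈Y , x∈A))
... | no  x∉A = outside-A (x∈p∩q⁺ (x∈Y , x∉p⇒x∈∁p x∉A))

allSubsets-complete : ∀ n (C : Subset n) → C ∈ˡ allSubsets n
allSubsets-complete zero    []            = Any.here refl
allSubsets-complete (suc n) (outside ∷ C) = ∈-++⁺ˡ (∈-map⁺ (outside ∷_) (allSubsets-complete n C))
allSubsets-complete (suc n) (inside  ∷ C) =
  ∈-++⁺ʳ (map (outside ∷_) (allSubsets n)) (∈-map⁺ (inside ∷_) (allSubsets-complete n C))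

OPTon-≤ : ∀ {n} (G : Graph n) (S C : Subset n) → IsVC G S C → OPTon G S ≤ ∣ C ∣
OPTon-≤ {n} G S C C-covers =
  foldr-preservesᵒ {P = _≤ ∣ C ∣} {f = _⊓_}
    (λ a b → [ m≤n⇒m⊓o≤n b , m≤n⇒o⊓m≤n a ]) ∣ S ∣ _
    (inj₂ (Any.map (λ e → ≤-reflexive (≡-sym e))
      (∈-map⁺ ∣_∣ (∈-filter⁺ (IsVC? G S) (allSubsets-complete n C) C-covers))))

Attained : ∀ {n} → Graph n → Subset n → ℕ → Set
Attained {n} G S k = Σ (Subset n) λ C → IsVC G S C × ∣ C ∣ ≡ k

-- OPT(G[S]) is attained: a minimum of attained sizes is attained, and S covers G[S].
OPTon-attained : ∀ {n} (G : Graph n) (S : Subset n) → Attained G S (OPTon G S)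
OPTon-attained {n} G S =
  foldr-preservesᵇ {P = Attained G S} {f = _⊓_} smaller
    (S , ((λ x∈S → x∈S) , λ u v u∈S _ _ → inj₁ u∈S) , refl)
    (All-map⁺ (All.map (λ {C} C-covers → C , C-covers , refl)
                       (all-filter (IsVC? G S) (allSubsets n))))
  where
  smaller : ∀ {a b} → Attained G S a → Attained G S b → Attained G S (a ⊓ b)
  smaller {a} {b} attained-a attained-b with ⊓-sel a b
  ... | inj₁ a⊓b≡a = subst (Attained G S) (≡-sym a⊓b≡a) attained-a
  ... | inj₂ a⊓b≡b = subst (Attained G S) (≡-sym a⊓b≡b) attained-b

minimumVC : ∀ {n} (G : Graph n) → Σ (Subset n) (IsMinVC G)
minimumVC G = OPTon-attained G ⊤

extend-cover : ∀ {n} (G : Graph n) (Y D : Subset n) → IsVC G (∁ Y) D → IsVC G ⊤ (D ∪ Y)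
extend-cover G Y D (_ , D-covers) = ⊆⊤ , cover
  where
  cover : ∀ u v → u ∈ ⊤ → v ∈ ⊤ → Adj G u v → u ∈ D ∪ Y ⊎ v ∈ D ∪ Y
  cover u v _ _ uv with u ∈? Y | v ∈? Y
  ... | yes u∈Y | _       = inj₁ (x∈p∪q⁺ (inj₂ u∈Y))
  ... | no  _   | yes v∈Y = inj₂ (x∈p∪q⁺ (inj₂ v∈Y))
  ... | no  u∉Y | no  v∉Y =
    [ (λ u∈D → inj₁ (p⊆p∪q Y u∈D)) , (λ v∈D → inj₂ (p⊆p∪q Y v∈D)) ]
      (D-covers u v (x∉p⇒x∈∁p u∉Y) (x∉p⇒x∈∁p v∉Y) uv)

restrict-cover : ∀ {n} (G : Graph n) (Y C : Subset n) → IsVC G ⊤ C → IsVC G (∁ Y) (C ∩ ∁ Y)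
restrict-cover G Y C (_ , C-covers) = (λ x∈C∖Y → proj₂ (x∈p∩q⁻ C (∁ Y) x∈C∖Y)) , cover
  where
  cover : ∀ u v → u ∈ ∁ Y → v ∈ ∁ Y → Adj G u v → u ∈ C ∩ ∁ Y ⊎ v ∈ C ∩ ∁ Y
  cover u v u∉Y v∉Y uv =
    [ (λ u∈C → inj₁ (x∈p∩q⁺ (u∈C , u∉Y))) , (λ v∈C → inj₂ (x∈p∩q⁺ (v∈C , v∉Y))) ]
      (C-covers u v ∈⊤ ∈⊤ uv)

-- For a blocking set Y, the cover of G obtained from a minimum cover of G − Y
-- by adding Y is not minimum, so OPT(G) < OPT(G − Y) + |Y|.
blocking-excess : ∀ {n} (G : Graph n) (Y : Subset n) → IsBlocking G Y → OPT G + 1 ≤ OPT-del G Y + ∣ Y ∣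
blocking-excess G Y blocking with OPTon-attained G (∁ Y)
... | D , D-covers , ∣D∣≡OPT-del = subst (_≤ OPT-del G Y + ∣ Y ∣) (+-comm 1 (OPT G)) OPT<∣K∣
  where
  K : Subset _
  K = D ∪ Y
  K-covers : IsVC G ⊤ K
  K-covers = extend-cover G Y D D-covers
  ∣K∣≡ : ∣ K ∣ ≡ OPT-del G Y + ∣ Y ∣
  ∣K∣≡ = trans (∣p∪q∣≡∣p∣+∣q∣ D Y (λ x∈D → x∈∁p⇒x∉p (proj₁ D-covers x∈D)))
               (cong (_+ ∣ Y ∣) ∣D∣≡OPT-del)
  K-not-minimum : ∣ K ∣ ≡ OPT G → ⊥
  K-not-minimum ∣K∣≡OPT = blocking (K , (K-covers , ∣K∣≡OPT) , λ x∈Y → x∈p∪q⁺ (inj₂ x∈Y))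
  OPT<∣K∣ : OPT G < OPT-del G Y + ∣ Y ∣
  OPT<∣K∣ = subst (OPT G <_) ∣K∣≡ (≤∧≢⇒< (OPTon-≤ G ⊤ K K-covers) (λ e → K-not-minimum (≡-sym e)))

-- If a cover C of G contains all of Y except possibly y, then C ∖ Y covers G − Y
-- and Y has at most one vertex outside C, so OPT(G − Y) + |Y| ≤ |C| + 1.
deletion-bound : ∀ {n} (G : Graph n) (Y C : Subset n) (y : Fin n) →
  IsVC G ⊤ C → Y ∩ ∁ ⁅ y ⁆ ⊆ C → OPT-del G Y + ∣ Y ∣ ≤ ∣ C ∣ + 1
deletion-bound G Y C y C-covers Y∖y⊆C = begin
  OPT-del G Y + ∣ Y ∣
    ≤⟨ +-monoˡ-≤ ∣ Y ∣ (OPTon-≤ G (∁ Y) (C ∩ ∁ Y) (restrict-cover G Y C C-covers)) ⟩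
  ∣ C ∩ ∁ Y ∣ + ∣ Y ∣
    ≡⟨ cong (∣ C ∩ ∁ Y ∣ +_) (≡-sym (∣p∩q∣+∣p∩∁q∣≡∣p∣ Y ⁅ y ⁆)) ⟩
  ∣ C ∩ ∁ Y ∣ + (∣ Y ∩ ⁅ y ⁆ ∣ + ∣ Y ∩ ∁ ⁅ y ⁆ ∣)
    ≤⟨ +-monoʳ-≤ ∣ C ∩ ∁ Y ∣ (+-mono-≤ at-most-y rest-in-C) ⟩
  ∣ C ∩ ∁ Y ∣ + (1 + ∣ C ∩ Y ∣)
    ≡⟨ rearrange (∣ C ∩ ∁ Y ∣) (∣ C ∩ Y ∣) ⟩
  ∣ C ∩ Y ∣ + ∣ C ∩ ∁ Y ∣ + 1
    ≡⟨ cong (_+ 1) (∣p∩q∣+∣p∩∁q∣≡∣p∣ C Y) ⟩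
  ∣ C ∣ + 1 ∎
  where
  open ≤-Reasoning
  open +-*-Solver
  at-most-y : ∣ Y ∩ ⁅ y ⁆ ∣ ≤ 1
  at-most-y = ≤-trans (p⊆q⇒∣p∣≤∣q∣ (p∩q⊆q Y ⁅ y ⁆)) (≤-reflexive (∣⁅x⁆∣≡1 y))
  rest-in-C : ∣ Y ∩ ∁ ⁅ y ⁆ ∣ ≤ ∣ C ∩ Y ∣
  rest-in-C = p⊆q⇒∣p∣≤∣q∣ (λ x∈Y∖y → x∈p∩q⁺ (Y∖y⊆C x∈Y∖y , proj₁ (x∈p∩q⁻ Y (∁ ⁅ y ⁆) x∈Y∖y)))
  rearrange : ∀ a b → a + (1 + b) ≡ b + a + 1
  rearrange = solve 2 (λ a b → a :+ (con 1 :+ b) := b :+ a :+ con 1) refl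

-- A set of vertices closed under adjacency, i.e. a union of connected components.
Closed : ∀ {n} → Graph n → Subset n → Set
Closed G A = ∀ {x y} → x ∈ A → Adj G x y → y ∈ A

splice : ∀ {n} → Subset n → Subset n → Subset n → Subset n
splice A P Q = (P ∩ A) ∪ (Q ∩ ∁ A)

⊆-splice : ∀ {n} (A : Subset n) {Y P Q : Subset n} → Y ∩ A ⊆ P → Y ∩ ∁ A ⊆ Q → Y ⊆ splice A P Q
⊆-splice A {Y} on-A off-A = ⊆-by-pieces A
  (λ x∈Y∩A → x∈p∪q⁺ (inj₁ (x∈p∩q⁺ (on-A x∈Y∩A , proj₂ (x∈p∩q⁻ Y A x∈Y∩A)))))
  (λ x∈Y∖A → x∈p∪q⁺ (inj₂ (x∈p∩q⁺ (off-A x∈Y∖A , proj₂ (x∈p∩q⁻ Y (∁ A) x∈Y∖A)))))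

-- Splicing two covers along a closed set gives a cover, since no edge crosses A.
splice-cover : ∀ {n} (G : Graph n) {A P Q : Subset n} → Closed G A →
  IsVC G ⊤ P → IsVC G ⊤ Q → IsVC G ⊤ (splice A P Q)
splice-cover G {A} {P} {Q} A-closed (_ , P-covers) (_ , Q-covers) = ⊆⊤ , cover
  where
  on-A : ∀ {x} → x ∈ A → x ∈ P → x ∈ splice A P Q
  on-A x∈A x∈P = x∈p∪q⁺ (inj₁ (x∈p∩q⁺ (x∈P , x∈A)))
  off-A : ∀ {x} → x ∉ A → x ∈ Q → x ∈ splice A P Q
  off-A x∉A x∈Q = x∈p∪q⁺ (inj₂ (x∈p∩q⁺ (x∈Q , x∉p⇒x∈∁p x∉A)))
  cover : ∀ u v → u ∈ ⊤ → v ∈ ⊤ → Adj G u v → u ∈ splice A P Q ⊎ v ∈ splice A P Q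
  cover u v _ _ uv with u ∈? A
  ... | yes u∈A =
    [ (λ u∈P → inj₁ (on-A u∈A u∈P)) , (λ v∈P → inj₂ (on-A (A-closed u∈A uv) v∈P)) ]
      (P-covers u v ∈⊤ ∈⊤ uv)
  ... | no  u∉A =
    [ (λ u∈Q → inj₁ (off-A u∉A u∈Q)) , (λ v∈Q → inj₂ (off-A v∉A v∈Q)) ]
      (Q-covers u v ∈⊤ ∈⊤ uv)
    where
    v∉A : v ∉ A
    v∉A v∈A = u∉A (A-closed v∈A (trans (Graph.sym G v u) uv))

splice-size : ∀ {n} (A P Q : Subset n) → ∣ splice A P Q ∣ + ∣ splice A Q P ∣ ≡ ∣ P ∣ + ∣ Q ∣
splice-size A P Q = begin
  ∣ splice A P Q ∣ + ∣ splice A Q P ∣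
    ≡⟨ cong₂ _+_ (pieces P Q) (pieces Q P) ⟩
  (∣ P ∩ A ∣ + ∣ Q ∩ ∁ A ∣) + (∣ Q ∩ A ∣ + ∣ P ∩ ∁ A ∣)
    ≡⟨ interchange (∣ P ∩ A ∣) (∣ Q ∩ ∁ A ∣) (∣ Q ∩ A ∣) (∣ P ∩ ∁ A ∣) ⟩
  (∣ P ∩ A ∣ + ∣ P ∩ ∁ A ∣) + (∣ Q ∩ A ∣ + ∣ Q ∩ ∁ A ∣)
    ≡⟨ cong₂ _+_ (∣p∩q∣+∣p∩∁q∣≡∣p∣ P A) (∣p∩q∣+∣p∩∁q∣≡∣p∣ Q A) ⟩
  ∣ P ∣ + ∣ Q ∣ ∎
  where
  open ≡-Reasoning
  open +-*-Solver
  pieces : ∀ R S → ∣ splice A R S ∣ ≡ ∣ R ∩ A ∣ + ∣ S ∩ ∁ A ∣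
  pieces R S = ∣p∪q∣≡∣p∣+∣q∣ (R ∩ A) (S ∩ ∁ A)
    (λ x∈R∩A x∈S∖A → x∈p⇒x∉∁p (proj₂ (x∈p∩q⁻ R A x∈R∩A)) (proj₂ (x∈p∩q⁻ S (∁ A) x∈S∖A)))
  interchange : ∀ a b c d → (a + b) + (c + d) ≡ (a + d) + (c + b)
  interchange = solve 4 (λ a b c d → (a :+ b) :+ (c :+ d) := (a :+ d) :+ (c :+ b)) refl

-- Splicing two minimum covers along a closed set gives a minimum cover: both
-- splices are covers, hence of size ≥ OPT, and their sizes add up to 2·OPT.
splice-minVC : ∀ {n} (G : Graph n) {A P Q : Subset n} → Closed G A →
  IsMinVC G P → IsMinVC G Q → IsMinVC G (splice A P Q)
splice-minVC G {A} {P} {Q} A-closed (P-covers , ∣P∣≡OPT) (Q-covers , ∣Q∣≡OPT) =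
  PQ-covers ,
  balanced (trans (splice-size A P Q) (cong₂ _+_ ∣P∣≡OPT ∣Q∣≡OPT))
           (OPTon-≤ G ⊤ _ PQ-covers) (OPTon-≤ G ⊤ _ QP-covers)
  where
  PQ-covers : IsVC G ⊤ (splice A P Q)
  PQ-covers = splice-cover G A-closed P-covers Q-covers
  QP-covers : IsVC G ⊤ (splice A Q P)
  QP-covers = splice-cover G A-closed Q-covers P-covers
  balanced : ∀ {a b c} → a + b ≡ c + c → c ≤ a → c ≤ b → a ≡ c
  balanced {a} {b} {c} a+b≡c+c c≤a c≤b =
    ≤-antisym (+-cancelʳ-≤ c a c (≤-trans (+-monoʳ-≤ a c≤b) (≤-reflexive a+b≡c+c))) c≤a

record Component {n} (G : Graph n) (u : Fin n) : Set where
  field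
    vertices  : Subset n
    source    : u ∈ vertices
    closed    : Closed G vertices
    reachable : ∀ {x} → x ∈ vertices → Connected G u x

Exit : ∀ {n} → Graph n → Subset n → Set
Exit G R = ∃₂ λ x y → x ∈ R × y ∉ R × Adj G x y

exit? : ∀ {n} (G : Graph n) (R : Subset n) → Dec (Exit G R)
exit? G R = any? λ x → any? λ y → (x ∈? R) ×-dec (¬? (y ∈? R) ×-dec (E G x y ≟ᵇ true))

-- Grow a set R of vertices reachable from u along exit edges until no edge
-- leaves it; each step shrinks the complement of R, which the fuel bounds.
grow : ∀ {n} (G : Graph n) {u : Fin n} (fuel : ℕ) (R : Subset n) → ∣ ∁ R ∣ ≤ fuel →
  u ∈ R → (∀ {x} → x ∈ R → Connected G u x) → Component G u
grow G fuel R bound u∈R reach with exit? G R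
... | no no-exit = record { vertices = R ; source = u∈R ; closed = closed ; reachable = reach }
  where
  closed : Closed G R
  closed {x} {y} x∈R xy = decidable-stable (y ∈? R) (λ y∉R → no-exit (x , y , x∈R , y∉R , xy))
... | yes (x , y , x∈R , y∉R , xy) = continue fuel bound
  where
  R′ : Subset _
  R′ = R ∪ ⁅ y ⁆
  shrinks : ∣ ∁ R′ ∣ < ∣ ∁ R ∣
  shrinks = p⊂q⇒∣p∣<∣q∣ (p⊂q⇒∁p⊃∁q (p⊆p∪q ⁅ y ⁆ , y , x∈p∪q⁺ (inj₂ (x∈⁅x⁆ y)) , y∉R))
  reach′ : ∀ {z} → z ∈ R′ → Connected G _ z
  reach′ {z} z∈R′ with x∈p∪q⁻ R ⁅ y ⁆ z∈R′
  ... | inj₁ z∈R    = reach z∈R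
  ... | inj₂ z∈⁅y⁆ = subst (Connected G _) (≡-sym (x∈⁅y⁆⇒x≡y y z∈⁅y⁆)) (reach x∈R ◅◅ (xy ◅ ε))
  continue : ∀ k → ∣ ∁ R ∣ ≤ k → Component G _
  continue zero    bound′ = ⊥-elim (n≮0 (≤-trans shrinks bound′))
  continue (suc k) bound′ = grow G k R′ (≤-pred (≤-trans shrinks bound′)) (p⊆p∪q ⁅ y ⁆ u∈R) reach′

component : ∀ {n} (G : Graph n) (u : Fin n) → Component G u
component {n} G u = grow G n ⁅ u ⁆ (∣p∣≤n (∁ ⁅ u ⁆)) (x∈⁅x⁆ u)
  (λ x∈⁅u⁆ → subst (Connected G u) (≡-sym (x∈⁅y⁆⇒x≡y u x∈⁅u⁆)) ε)

-- A blocking set is nonempty, since every graph has a minimum cover.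
blocking-nonempty : ∀ {n} (G : Graph n) (Y : Subset n) → IsBlocking G Y → Nonempty Y
blocking-nonempty G Y blocking with nonempty? Y
... | yes nonempty = nonempty
... | no  empty    =
  let C , C-min = minimumVC G in ⊥-elim (blocking (C , C-min , λ x∈Y → ⊥-elim (empty (_ , x∈Y))))

module MinimalBlocking {n} (G : Graph n) (Y : Subset n) (minimal-blocking : IsMinimalBlocking G Y) where

  blocking : IsBlocking G Y
  blocking = proj₁ minimal-blocking

  restriction-covered : ∀ {A y} → y ∈ Y → y ∉ A → ¬ IsBlocking G (Y ∩ A)
  restriction-covered {A} y∈Y y∉A = proj₂ minimal-blocking (Y ∩ A) (∩-⊂ y∈Y y∉A)

  removal-covered : ∀ {y} → y ∈ Y → ¬ IsBlocking G (Y ∩ ∁ ⁅ y ⁆)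
  removal-covered {y} y∈Y = restriction-covered y∈Y (x∈p⇒x∉∁p (x∈⁅x⁆ y))

  -- (i) A vertex of Y forced into every minimum cover could be dropped from Y.
  not-forced : ∀ v → v ∈ Y → ¬ (∀ C → IsMinVC G C → v ∈ C)
  not-forced v v∈Y forced = removal-covered v∈Y λ (C , C-min , Y∖v⊆C) →
    blocking (C , C-min , ⊆-by-pieces ⁅ v ⁆ (only-v C (forced C C-min)) Y∖v⊆C)
    where
    only-v : ∀ C → v ∈ C → Y ∩ ⁅ v ⁆ ⊆ C
    only-v C v∈C x∈Y∩v = subst (_∈ C) (≡-sym (x∈⁅y⁆⇒x≡y v (proj₂ (x∈p∩q⁻ Y ⁅ v ⁆ x∈Y∩v)))) v∈C

  -- (ii) A vertex v of Y in no minimum cover is blocking by itself, so Y = {v}.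
  excluded-alone : (Σ (Fin n) λ v → v ∈ Y × (∀ C → IsMinVC G C → v ∉ C)) → ∣ Y ∣ ≡ 1
  excluded-alone (v , v∈Y , excluded) = trans (cong ∣_∣ (⊆-antisym Y⊆⁅v⁆ ⁅v⁆⊆Y)) (∣⁅x⁆∣≡1 v)
    where
    Y⊆⁅v⁆ : Y ⊆ ⁅ v ⁆
    Y⊆⁅v⁆ {x} x∈Y with x ≟ᶠ v
    ... | yes refl = x∈⁅x⁆ v
    ... | no  x≢v  = ⊥-elim (restriction-covered x∈Y (x≢y⇒x∉⁅y⁆ x≢v) λ (C , C-min , Y∩v⊆C) →
                       excluded C C-min (Y∩v⊆C (x∈p∩q⁺ (v∈Y , x∈⁅x⁆ v))))
    ⁅v⁆⊆Y : ⁅ v ⁆ ⊆ Y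
    ⁅v⁆⊆Y x∈⁅v⁆ = subst (_∈ Y) (≡-sym (x∈⁅y⁆⇒x≡y v x∈⁅v⁆)) v∈Y

  -- A closed set meeting Y contains Y: otherwise both pieces of Y along A lie
  -- in minimum covers, whose splice along A is a minimum cover containing Y.
  inside-closed : ∀ {A u} → Closed G A → u ∈ Y → u ∈ A → Y ⊆ A
  inside-closed {A} A-closed u∈Y u∈A {v} v∈Y = decidable-stable (v ∈? A) λ v∉A →
    restriction-covered v∈Y v∉A λ (P , P-min , Y∩A⊆P) →
    restriction-covered u∈Y (x∈p⇒x∉∁p u∈A) λ (Q , Q-min , Y∖A⊆Q) →
    blocking (splice A P Q , splice-minVC G A-closed P-min Q-min , ⊆-splice A Y∩A⊆P Y∖A⊆Q)

  connected : ∀ u v → u ∈ Y → v ∈ Y → Connected G u v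
  connected u v u∈Y v∈Y = reachable (inside-closed closed u∈Y source v∈Y)
    where open Component (component G u)

  -- (iv) The lower bound holds for every blocking set; the upper bound uses a
  -- minimum cover containing Y ∖ {y}.
  deletion-identity : OPT-del G Y + ∣ Y ∣ ≡ OPT G + 1
  deletion-identity = ≤-antisym upper (blocking-excess G Y blocking)
    where
    upper : OPT-del G Y + ∣ Y ∣ ≤ OPT G + 1
    upper with blocking-nonempty G Y blocking
    ... | y , y∈Y = decidable-stable (_ ≤? _) λ ¬upper →
      removal-covered y∈Y λ (C , (C-covers , ∣C∣≡OPT) , Y∖y⊆C) →
      ¬upper (subst (λ k → OPT-del G Y + ∣ Y ∣ ≤ k + 1) ∣C∣≡OPT (deletion-bound G Y C y C-covers Y∖y⊆C))

proposition18 : ∀ {n} (G : Graph n) (Y : Subset n) → IsMinimalBlocking G Y →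
    (∀ v → v ∈ Y → ¬ (∀ C → IsMinVC G C → v ∈ C))
    × ((Σ (Fin n) λ v → v ∈ Y × (∀ C → IsMinVC G C → v ∉ C)) → ∣ Y ∣ ≡ 1)
    × (∀ u v → u ∈ Y → v ∈ Y → Connected G u v)
    × (OPT-del G Y + ∣ Y ∣ ≡ OPT G + 1)
proposition18 G Y minimal-blocking = not-forced , excluded-alone , connected , deletion-identity
  where open MinimalBlocking G Y minimal-blocking
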